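{- Let $h\ge1$, let $\delta=(\delta_1,\dots,\delta_h)\in\{\pm1\}^h$ and let $\mathbf a=(a_0,\dots,a_h)\in\mathbb{R}_{\ge0}^{h+1}$. Set $\delta_{h+1}:=-\delta_h$, $\delta_0:=-\delta_1$ and $\hat I_\delta=\{0\le j\le h:(\delta_j,\delta_{j+1})=(1,-1)\}$. For $\emptyset\ne J\subseteq\hat I_\delta$ let $\hat\sigma_J(\delta)\in\{\pm1\}^h$ be obtained from $\delta$ by swapping the signs of $(\delta_j,\delta_{j+1})$ for every $j\in J$ (only the entries with indices in $\{1,\dots,h\}$ being recorded). Then \[ \mathrm{DSPP}^{\mathbf a}_\delta(z;q)=\sum_{\emptyset\ne J\subseteq\hat I_\delta}(-1)^{|J|-1}\frac{\mathrm{DSPP}^{\mathbf a}_{\hat\sigma_J(\delta)}\bigl(zq^{\sum_{j\in J}a_j};q\bigr)}{1-zq^{\sum_{j\in J}a_j}}. \]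
   Context: Partitions are weakly decreasing, eventually zero sequences of nonnegative integers; $\lambda\succeq\mu$ (equivalently $\mu\preceq\lambda$) means $\lambda_1\ge\mu_1\ge\lambda_2\ge\mu_2\ge\cdots$. A skew double shifted plane partition (DSPP) of profile $\delta$ is an $(h+1)$-tuple $(\lambda^0,\dots,\lambda^h)$ of partitions with $\lambda^{j-1}\succeq\lambda^j$ if $\delta_j=-1$ and $\lambda^{j-1}\preceq\lambda^j$ if $\delta_j=1$ ($1\le j\le h$); $\mathcal{DSPP}_\delta$ is the set of these, including the empty one. Its weighted size is $|\lambda|_{\mathbf a}=\sum_{j=0}^{h}a_j|\lambda^j|$, $\max(\lambda)$ is the largest part among all $\lambda^j$ ($0$ if all empty), and $\mathrm{DSPP}^{\mathbf a}_\delta(z;q)=\sum_{\lambda\in\mathcal{DSPP}_\delta}z^{\max(\lambda)}q^{|\lambda|_{\mathbf a}}$. -}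

module Defs where

open import Data.Nat using (ℕ; zero; suc; _+_; _∸_; _≤_; _<_; _⊔_; _<ᵇ_)
open import Data.Bool using (Bool; true; false; if_then_else_)
open import Data.Sign using (Sign; opposite) renaming (+ to ⊕; - to ⊖)
open import Data.List using (List; []; _∷_; [_]; length; map; _++_; filter; foldr)
open import Data.Nat.ListAction using (sum)
open import Data.List.Relation.Unary.All using (All)
open import Data.List.Relation.Unary.Unique.Propositional using (Unique)
open import Data.List.Membership.Propositional using (_∈_)
open import Data.Vec using (Vec; lookup; tabulate; toList) renaming ([] to []ᵥ; _∷_ to _∷ᵥ_)
open import Data.Fin using (Fin; toℕ; inject₁) renaming (suc to fsuc)
open import Data.Fin.Subset using (Subset; outside; inside; Nonempty; _⊆_; ∣_∣)
open import Data.Fin.Subset.Properties using (nonempty?; _⊆?_)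
open import Data.Integer using (ℤ; -1ℤ; _^_; _*_) renaming (+_ to ⁺_; _+_ to _+ℤ_)
open import Data.Product using (Σ; _×_; ∃)
open import Relation.Nullary.Decidable using (_×-dec_)
open import Function.Bundles using (_⇔_)

-- Partitions, represented canonically as the finite list of their
-- nonzero parts  λ₁ ≥ λ₂ ≥ … > 0 .

-- i-th part (0-indexed), 0 beyond the length: the eventually-zero sequence.
part : List ℕ → ℕ → ℕ
part []       _       = 0
part (x ∷ _)  zero    = x
part (_ ∷ xs) (suc i) = part xs i

IsPartition : List ℕ → Set
IsPartition l = All (λ x → 0 < x) l × (∀ i → part l (suc i) ≤ part l i)

_⪰_ : List ℕ → List ℕ → Set
lam ⪰ mu = ∀ i → part mu i ≤ part lam i × part lam (suc i) ≤ part mu i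

size : List ℕ → ℕ
size = sum

Step : Sign → List ℕ → List ℕ → Set
Step ⊖ l m = l ⪰ m
Step ⊕ l m = m ⪰ l

IsDSPP : ∀ {h} → Vec Sign h → Vec (List ℕ) (suc h) → Set
IsDSPP {h} δ lam =
  (∀ j → IsPartition (lookup lam j)) ×
  (∀ (k : Fin h) → Step (lookup δ k) (lookup lam (inject₁ k)) (lookup lam (fsuc k)))

maxPart : ∀ {n} → Vec (List ℕ) n → ℕ
maxPart lam = foldr (λ l acc → part l 0 ⊔ acc) 0 (toList lam)

HasCount : {A : Set} → (A → Set) → ℕ → Set
HasCount {A} P c = Σ (List A) λ L → Unique L × (∀ x → (x ∈ L) ⇔ P x) × length L ≡ c
  where open import Relation.Binary.PropositionalEquality using (_≡_)

vget : ∀ {A : Set} {n} → Vec A n → A → ℕ → A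
vget []ᵥ       d _       = d
vget (x ∷ᵥ _)  d zero    = x
vget (_ ∷ᵥ xs) d (suc i) = vget xs d i

-- δ_i for 1 ≤ i ≤ h (paper indexing), δ₀ := -δ₁, δ_{h+1} := -δ_h.
-- (values at indices > h+1 are never used)
δ̂ : ∀ {h} → Vec Sign h → ℕ → Sign
δ̂ {h} δ zero    = opposite (vget δ ⊕ 0)
δ̂ {h} δ (suc i) = if i <ᵇ h then vget δ ⊕ i else opposite (vget δ ⊕ (h ∸ 1))

isPlusMinus : Sign → Sign → Bool
isPlusMinus ⊕ ⊖ = true
isPlusMinus _ _ = false

Îδ : ∀ {h} → Vec Sign h → Subset (suc h)
Îδ δ = tabulate (λ j → isPlusMinus (δ̂ δ (toℕ j)) (δ̂ δ (suc (toℕ j))))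

bit : ∀ {n} → Subset n → ℕ → Bool
bit []ᵥ       _       = false
bit (b ∷ᵥ _)  zero    = b
bit (_ ∷ᵥ p)  (suc i) = bit p i

-- σ̂_J(δ): swap (δ_j , δ_{j+1}) for each j ∈ J, record entries 1..h.
σ̂ : ∀ {h} → Subset (suc h) → Vec Sign h → Vec Sign h
σ̂ J δ = tabulate λ k →
  let i = suc (toℕ k) in
  if bit J i then δ̂ δ (suc i)
  else if bit J (toℕ k) then δ̂ δ (toℕ k)
  else δ̂ δ i

allSubsets : ∀ n → List (Subset n)
allSubsets zero    = [ []ᵥ ]
allSubsets (suc n) = map (outside ∷ᵥ_) (allSubsets n) ++ map (inside ∷ᵥ_) (allSubsets n)

admissibleJ : ∀ {h} → Vec Sign h → List (Subset (suc h))
admissibleJ {h} δ = filter (λ J → nonempty? J ×-dec (J ⊆? Îδ δ)) (allSubsets (suc h))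

sumℤ : List ℤ → ℤ
sumℤ = foldr _+ℤ_ (⁺ 0)

signedSum : ∀ {h} → Vec Sign h → (Subset (suc h) → ℕ) → ℤ
signedSum δ c = sumℤ (map (λ J → (-1ℤ ^ (∣ J ∣ ∸ 1)) * ⁺ (c J)) (admissibleJ δ))

-- Coefficient sets.  We use the refined (multivariate) weight
-- z^{max λ} ∏_j x_j^{|λ^j|}, x_j standing for q^{a_j}.

open import Relation.Binary.PropositionalEquality using (_≡_)

-- coefficient of z^m ∏ x_j^{n_j} in DSPP_δ :
LHSSet : ∀ {h} → Vec Sign h → ℕ → Vec ℕ (suc h) → Vec (List ℕ) (suc h) → Set
LHSSet δ m n lam =
  IsDSPP δ lam × maxPart lam ≡ m × (∀ j → size (lookup lam j) ≡ lookup n j)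

-- coefficient of z^m ∏ x_j^{n_j} in
--   DSPP_{σ̂_J δ}(z ∏_{j∈J} x_j) / (1 - z ∏_{j∈J} x_j)
--   = Σ_μ Σ_{k≥0} z^{max μ + k} ∏_j x_j^{|μ^j| + [j∈J](max μ + k)} :
-- the μ ∈ DSPP_{σ̂_J δ} with max μ ≤ m and |μ^j| + [j∈J]·m = n_j.
RHSSet : ∀ {h} → Vec Sign h → Subset (suc h) → ℕ → Vec ℕ (suc h) →
         Vec (List ℕ) (suc h) → Set
RHSSet δ J m n mu =
  IsDSPP (σ̂ J δ) mu × maxPart mu ≤ m ×
  (∀ j → size (lookup mu j) + (if lookup J j then m else 0) ≡ lookup n j)

-- Fix m and the row sizes n, and let B be the set of DSPPs of profile δ with all parts at most m
-- and row sizes n; for λ ∈ B let H(λ) be the set of rows whose largest part equals m.  Across a +1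
-- step of δ the largest parts weakly increase and across a −1 step they weakly decrease, so if m is
-- attained at all it is attained at a peak j ∈ Î_δ: max λ = m iff H(λ) ∩ Î_δ ≠ ∅.  Inclusion–exclusion
-- over the nonempty J ⊆ Î_δ writes the number of these λ as the alternating sum of the numbers of
-- λ ∈ B with J ⊆ H(λ).  Deleting the first part (= m) of each row j ∈ J maps the latter bijectively
-- onto the DSPPs μ of profile σ̂_J(δ) with max μ ≤ m and |μ^j| + [j ∈ J] m = n_j, the coefficient
-- counted by the J-th summand: at a peak the deletion reverses both interlacings around row j,
-- which swaps δ_j and δ_{j+1}.

module Submission where

open import Defs

open import Data.Bool using (Bool; true; false; T; not; _∧_; _∨_; if_then_else_)
import Data.Bool.Properties as BoolP
open import Data.Empty using (⊥-elim)
open import Data.Fin using (Fin; toℕ; inject₁; fromℕ<) renaming (zero to fzero; suc to fsuc)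
import Data.Fin.Properties as FinP
open import Data.Fin.Subset using (Subset; Nonempty; _⊆_; _∩_; ∣_∣; inside; outside) renaming (_∈_ to _∈ₛ_)
open import Data.Fin.Subset.Properties using (nonempty?; _⊆?_; drop-∷-⊆; x∈p∩q⁺; x∈p∩q⁻)
open import Data.Integer using (ℤ; +_; 0ℤ; 1ℤ; -1ℤ; _^_) renaming (_+_ to _+ℤ_; _*_ to _*ℤ_; _-_ to _-ℤ_)
import Data.Integer.Properties as ℤP
open import Data.Integer.Solver using (module +-*-Solver)
open import Data.List
  using (List; []; _∷_; [_]; _++_; length; map; filter; deduplicate; upTo; cartesianProductWith; drop)
import Data.List.Properties as ListP
open import Data.List.Membership.Propositional using (_∈_)
open import Data.List.Membership.Propositional.Properties
  using (∈-filter⁺; ∈-filter⁻; ∈-map⁺; ∈-map⁻; ∈-deduplicate⁺; ∈-upTo⁺; ∈-cartesianProductWith⁺)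
open import Data.List.Relation.Unary.All as All using (All) renaming ([] to []ᵃ; _∷_ to _∷ᵃ_)
import Data.List.Relation.Unary.All.Properties as AllP
open import Data.List.Relation.Unary.AllPairs using ([]; _∷_)
open import Data.List.Relation.Unary.Any using (here; there)
open import Data.List.Relation.Unary.Unique.Propositional using (Unique)
import Data.List.Relation.Unary.Unique.Propositional.Properties as UniqueP
import Data.List.Relation.Unary.Unique.DecPropositional.Properties as UniqueDecP
open import Data.Nat using (ℕ; zero; suc; _+_; _∸_; _≤_; _<_; _<ᵇ_; _≡ᵇ_; _≤?_; _<?_; z≤n; s≤s)
import Data.Nat.Properties as ℕP
open import Data.Nat.ListAction using (sum)
open import Data.Product using (Σ; ∃; _×_; _,_; proj₁; proj₂)
open import Data.Sign using (Sign; opposite) renaming (+ to ⊕; - to ⊖)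
import Data.Sign.Properties as SignP
open import Data.Sum using (inj₁; inj₂)
open import Data.Vec using (Vec; lookup; here; there) renaming ([] to []ᵛ; _∷_ to _∷ᵛ_)
import Data.Vec as Vec
import Data.Vec.Properties as VecP
open import Function.Base using (_∘_; case_of_)
open import Function.Bundles using (_⇔_; mk⇔; Equivalence)
open import Function.Properties.Equivalence using () renaming (trans to ⇔-trans)
open import Relation.Binary.Definitions using (DecidableEquality)
open import Relation.Binary.PropositionalEquality
  using (_≡_; refl; sym; trans; cong; cong₂; subst; subst₂; module ≡-Reasoning)
open import Relation.Nullary using (Dec; yes; no; does)
open import Relation.Nullary.Decidable using (map′; _×-dec_)
open import Relation.Unary using (Decidable)

open Equivalence using (to; from)
open +-*-Solver
open ≡-Reasoning

-- Enumerating finite sets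

Enumerates : {A : Set} → (A → Set) → List A → Set
Enumerates P L = Unique L × (∀ x → (x ∈ L) ⇔ P x)

module _ {A : Set} {P : A → Set} where

  enumerates⇒hasCount : ∀ {L c} → Enumerates P L → length L ≡ c → HasCount P c
  enumerates⇒hasCount (unique , ∈⇔) length≡c = _ , unique , ∈⇔ , length≡c

  enumerates-⇔ : ∀ {Q : A → Set} {L} → (∀ x → P x ⇔ Q x) → Enumerates P L → Enumerates Q L
  enumerates-⇔ P⇔Q (unique , ∈⇔) = unique , λ x → ⇔-trans (∈⇔ x) (P⇔Q x)

  filter-enumerates : ∀ {Q : A → Set} (Q? : Decidable Q) {L} → Enumerates P L →
                      Enumerates (λ x → P x × Q x) (filter Q? L)
  filter-enumerates Q? {L} (unique , ∈⇔) = UniqueP.filter⁺ Q? unique , λ x → mk⇔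
    (λ x∈ → let x∈L , Qx = ∈-filter⁻ Q? {xs = L} x∈ in to (∈⇔ x) x∈L , Qx)
    (λ (Px , Qx) → ∈-filter⁺ Q? (from (∈⇔ x) Px) Qx)

  enumerate : DecidableEquality A → Decidable P → (S : List A) → (∀ x → P x → x ∈ S) →
              Σ (List A) (Enumerates P)
  enumerate _≟_ P? S P⊆S = filter P? (deduplicate _≟_ S) ,
    UniqueP.filter⁺ P? (UniqueDecP.deduplicate-! _≟_ S) ,
    λ x → mk⇔ (λ x∈ → proj₂ (∈-filter⁻ P? {xs = deduplicate _≟_ S} x∈))
              (λ Px → ∈-filter⁺ P? (∈-deduplicate⁺ _≟_ (P⊆S x Px)) Px)

module _ {A B : Set} {P : A → Set} {Q : B → Set} (f : A → B) (g : B → A)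
         (f-maps : ∀ x → P x → Q (f x)) (g-maps : ∀ y → Q y → P (g y))
         (g∘f : ∀ x → P x → g (f x) ≡ x) (f∘g : ∀ y → Q y → f (g y) ≡ y) where

  private
    map-unique : ∀ {L} → (∀ x → x ∈ L → P x) → Unique L → Unique (map f L)
    map-unique {[]} _ [] = []
    map-unique {x ∷ L} ∈⇒P (x∉L ∷ unique) =
      AllP.map⁺ (All.tabulate λ {y} y∈L fx≡fy → All.lookup x∉L y∈L (begin
        x         ≡⟨ sym (g∘f x (∈⇒P x (here refl))) ⟩
        g (f x)   ≡⟨ cong g fx≡fy ⟩
        g (f y)   ≡⟨ g∘f y (∈⇒P y (there y∈L)) ⟩
        y         ∎))
      ∷ map-unique (λ y y∈L → ∈⇒P y (there y∈L)) unique

  map-enumerates : ∀ {L} → Enumerates P L → Enumerates Q (map f L)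
  map-enumerates {L} (unique , ∈⇔) = map-unique (λ x → to (∈⇔ x)) unique , λ y → mk⇔
    (λ y∈ → let x , x∈L , y≡fx = ∈-map⁻ f y∈ in subst Q (sym y≡fx) (f-maps x (to (∈⇔ x) x∈L)))
    (λ Qy → subst (_∈ map f L) (f∘g y Qy) (∈-map⁺ f (from (∈⇔ (g y)) (g-maps y Qy))))

lists≤ : ℕ → ℕ → List (List ℕ)
lists≤ zero    b = [ [] ]
lists≤ (suc k) b = [] ∷ cartesianProductWith _∷_ (upTo (suc b)) (lists≤ k b)

∈-lists≤ : ∀ {k b} l → length l ≤ k → All (_≤ b) l → l ∈ lists≤ k b
∈-lists≤ {zero}  []      _          _          = here refl
∈-lists≤ {suc k} []      _          _          = here refl
∈-lists≤ {suc k} (x ∷ l) (s≤s len≤) (x≤b ∷ᵃ l≤b) =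
  there (∈-cartesianProductWith⁺ _∷_ (∈-upTo⁺ (s≤s x≤b)) (∈-lists≤ l len≤ l≤b))

choices : {A : Set} {k : ℕ} → Vec (List A) k → List (Vec A k)
choices []ᵛ       = [ []ᵛ ]
choices (C ∷ᵛ Cs) = cartesianProductWith _∷ᵛ_ C (choices Cs)

∈-choices : {A : Set} {k : ℕ} {Cs : Vec (List A) k} (v : Vec A k) →
            (∀ j → lookup v j ∈ lookup Cs j) → v ∈ choices Cs
∈-choices {Cs = []ᵛ}     []ᵛ       _    = here refl
∈-choices {Cs = _ ∷ᵛ Cs} (x ∷ᵛ v) v∈Cs =
  ∈-cartesianProductWith⁺ _∷ᵛ_ (v∈Cs fzero) (∈-choices {Cs = Cs} v (v∈Cs ∘ fsuc))

length≤sum : ∀ {l} → All (0 <_) l → length l ≤ sum l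
length≤sum []ᵃ           = z≤n
length≤sum (0<x ∷ᵃ 0<l) = ℕP.+-mono-≤ 0<x (length≤sum 0<l)

all≤sum : ∀ l → All (_≤ sum l) l
all≤sum []      = []ᵃ
all≤sum (x ∷ l) = ℕP.m≤m+n x (sum l) ∷ᵃ All.map (λ y≤ → ℕP.≤-trans y≤ (ℕP.m≤n+m (sum l) x)) (all≤sum l)

partition∈lists≤ : ∀ {B} l → IsPartition l → size l ≤ B → l ∈ lists≤ B B
partition∈lists≤ l (0<parts , _) size≤B = ∈-lists≤ l (ℕP.≤-trans (length≤sum 0<parts) size≤B)
  (All.map (λ x≤ → ℕP.≤-trans x≤ size≤B) (all≤sum l))

∀-dec-eventually : {P : ℕ → Set} → Decidable P → ∀ N → (∀ i → N ≤ i → P i) → Dec (∀ i → P i)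
∀-dec-eventually {P} P? N P-beyond = map′ everywhere (λ ∀P {i} _ → ∀P i) (ℕP.allUpTo? P? N)
  where
  everywhere : (∀ {i} → i < N → P i) → ∀ i → P i
  everywhere P-below i with i <? N
  ... | yes i<N = P-below i<N
  ... | no  i≮N = P-beyond i (ℕP.≮⇒≥ i≮N)

part-beyond : ∀ l {i} → length l ≤ i → part l i ≡ 0
part-beyond []      _           = refl
part-beyond (_ ∷ l) (s≤s len≤i) = part-beyond l len≤i

0≤-beyond : ∀ {l i k} → length l ≤ i → part l i ≤ k
0≤-beyond {l} len≤i = subst (_≤ _) (sym (part-beyond l len≤i)) z≤n

isPartition? : Decidable IsPartition
isPartition? l = All.all? (0 <?_) l ×-dec
  ∀-dec-eventually (λ i → part l (suc i) ≤? part l i) (length l)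
    (λ _ len≤i → 0≤-beyond {l} (ℕP.m≤n⇒m≤1+n len≤i))

_⪰?_ : ∀ lam mu → Dec (lam ⪰ mu)
lam ⪰? mu = ∀-dec-eventually (λ i → (part mu i ≤? part lam i) ×-dec (part lam (suc i) ≤? part mu i))
  (length lam + length mu)
  (λ _ len≤i → 0≤-beyond {mu} (ℕP.≤-trans (ℕP.m≤n+m _ _) len≤i)
             , 0≤-beyond {lam} (ℕP.m≤n⇒m≤1+n (ℕP.≤-trans (ℕP.m≤m+n _ _) len≤i)))

step? : ∀ s l m → Dec (Step s l m)
step? ⊖ l m = l ⪰? m
step? ⊕ l m = m ⪰? l

isDSPP? : ∀ {h} (δ : Vec Sign h) → Decidable (IsDSPP δ)
isDSPP? δ x = FinP.all? (λ j → isPartition? (lookup x j))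
        ×-dec FinP.all? (λ k → step? (lookup δ k) (lookup x (inject₁ k)) (lookup x (fsuc k)))

partitionTuples-enumeration : ∀ {k} {P : Vec (List ℕ) k → Set} (n : Vec ℕ k) → Decidable P →
  (∀ x → P x → ∀ j → IsPartition (lookup x j) × size (lookup x j) ≤ lookup n j) →
  Σ (List (Vec (List ℕ) k)) (Enumerates P)
partitionTuples-enumeration n P? P-bounded =
  enumerate (VecP.≡-dec (ListP.≡-dec ℕP._≟_)) P? (choices (Vec.map (λ B → lists≤ B B) n))
    λ x Px → ∈-choices {Cs = Vec.map (λ B → lists≤ B B) n} x λ j →
      let isPartition , size≤n = P-bounded x Px j in
      subst (lookup x j ∈_) (sym (VecP.lookup-map j (λ B → lists≤ B B) n))
            (partition∈lists≤ (lookup x j) isPartition size≤n)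

BoundedDSPP : ∀ {h} → Vec Sign h → ℕ → Vec ℕ (suc h) → Vec (List ℕ) (suc h) → Set
BoundedDSPP δ m n x = IsDSPP δ x × maxPart x ≤ m × (∀ j → size (lookup x j) ≡ lookup n j)

boundedDSPP-enumeration : ∀ {h} (δ : Vec Sign h) m n → Σ _ (Enumerates (BoundedDSPP δ m n))
boundedDSPP-enumeration δ m n = partitionTuples-enumeration n
  (λ x → isDSPP? δ x ×-dec maxPart x ≤? m ×-dec FinP.all? (λ j → size (lookup x j) ℕP.≟ lookup n j))
  (λ x ((isPartition , _) , _ , sizes) j → isPartition j , ℕP.≤-reflexive (sizes j))

RHSSet-enumeration : ∀ {h} (δ : Vec Sign h) J m n → Σ _ (Enumerates (RHSSet δ J m n))
RHSSet-enumeration δ J m n = partitionTuples-enumeration n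
  (λ x → isDSPP? (σ̂ J δ) x ×-dec maxPart x ≤? m ×-dec
         FinP.all? (λ j → size (lookup x j) + (if lookup J j then m else 0) ℕP.≟ lookup n j))
  (λ x ((isPartition , _) , _ , sizes) j →
     isPartition j , ℕP.≤-trans (ℕP.m≤m+n _ _) (ℕP.≤-reflexive (sizes j)))

𝟙 : Bool → ℤ
𝟙 b = if b then 1ℤ else 0ℤ

module _ {A : Set} where

  sumℤ-map-++ : (f : A → ℤ) (xs ys : List A) →
                sumℤ (map f (xs ++ ys)) ≡ sumℤ (map f xs) +ℤ sumℤ (map f ys)
  sumℤ-map-++ f []       ys = sym (ℤP.+-identityˡ _)
  sumℤ-map-++ f (x ∷ xs) ys = trans (cong (f x +ℤ_) (sumℤ-map-++ f xs ys)) (sym (ℤP.+-assoc (f x) _ _))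

  sumℤ-cong-∈ : ∀ L {f g : A → ℤ} → (∀ x → x ∈ L → f x ≡ g x) → sumℤ (map f L) ≡ sumℤ (map g L)
  sumℤ-cong-∈ []      _   = refl
  sumℤ-cong-∈ (x ∷ L) f≡g = cong₂ _+ℤ_ (f≡g x (here refl)) (sumℤ-cong-∈ L λ y y∈L → f≡g y (there y∈L))

  sumℤ-cong : ∀ L {f g : A → ℤ} → (∀ x → f x ≡ g x) → sumℤ (map f L) ≡ sumℤ (map g L)
  sumℤ-cong L f≡g = sumℤ-cong-∈ L λ x _ → f≡g x

  sumℤ-zero : ∀ L → sumℤ (map (λ (_ : A) → 0ℤ) L) ≡ 0ℤ
  sumℤ-zero []      = refl
  sumℤ-zero (_ ∷ L) = trans (ℤP.+-identityˡ _) (sumℤ-zero L)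

  *-sumℤ : ∀ s L (f : A → ℤ) → s *ℤ sumℤ (map f L) ≡ sumℤ (map (λ x → s *ℤ f x) L)
  *-sumℤ s []      f = ℤP.*-zeroʳ s
  *-sumℤ s (x ∷ L) f = trans (ℤP.*-distribˡ-+ s (f x) _) (cong (s *ℤ f x +ℤ_) (*-sumℤ s L f))

  sumℤ-map-- : ∀ L (f g : A → ℤ) → sumℤ (map (λ x → f x -ℤ g x) L) ≡ sumℤ (map f L) -ℤ sumℤ (map g L)
  sumℤ-map-- []      f g = refl
  sumℤ-map-- (x ∷ L) f g = trans (cong (f x -ℤ g x +ℤ_) (sumℤ-map-- L f g))
    (solve 4 (λ a b c d → (a :- b) :+ (c :- d) := (a :+ c) :- (b :+ d)) refl (f x) (g x) _ _)

  sumℤ-filter : {P : A → Set} (P? : Decidable P) (g : A → ℤ) (L : List A) →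
                sumℤ (map g (filter P? L)) ≡ sumℤ (map (λ x → 𝟙 (does (P? x)) *ℤ g x) L)
  sumℤ-filter P? g []      = refl
  sumℤ-filter P? g (x ∷ L) with does (P? x)
  ... | true  = cong₂ _+ℤ_ (sym (ℤP.*-identityˡ (g x))) (sumℤ-filter P? g L)
  ... | false = trans (sumℤ-filter P? g L) (sym (ℤP.+-identityˡ _))

  length-filter : {P : A → Set} (P? : Decidable P) (L : List A) →
                  + length (filter P? L) ≡ sumℤ (map (λ x → 𝟙 (does (P? x))) L)
  length-filter P? []      = refl
  length-filter P? (x ∷ L) with does (P? x)
  ... | true  = trans (ℤP.pos-+ 1 (length (filter P? L))) (cong (1ℤ +ℤ_) (length-filter P? L))
  ... | false = trans (length-filter P? L) (sym (ℤP.+-identityˡ _))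

sumℤ-swap : {A B : Set} (F : A → B → ℤ) (As : List A) (Bs : List B) →
  sumℤ (map (λ a → sumℤ (map (F a) Bs)) As) ≡ sumℤ (map (λ b → sumℤ (map (λ a → F a b) As)) Bs)
sumℤ-swap F []       Bs = sym (sumℤ-zero Bs)
sumℤ-swap F (a ∷ As) Bs = trans (cong (sumℤ (map (F a) Bs) +ℤ_) (sumℤ-swap F As Bs)) (sym (sumℤ-map-+ Bs))
  where
  sumℤ-map-+ : ∀ Cs → sumℤ (map (λ b → F a b +ℤ sumℤ (map (λ a′ → F a′ b) As)) Cs)
                    ≡ sumℤ (map (F a) Cs) +ℤ sumℤ (map (λ b → sumℤ (map (λ a′ → F a′ b) As)) Cs)
  sumℤ-map-+ []       = refl
  sumℤ-map-+ (c ∷ Cs) = trans (cong (F a c +ℤ sumℤ (map (λ a′ → F a′ c) As) +ℤ_) (sumℤ-map-+ Cs))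
    (solve 4 (λ p q r s → (p :+ q) :+ (r :+ s) := (p :+ r) :+ (q :+ s)) refl (F a c) _ _ _)

-- Inclusion–exclusion over subsets

private
  nonemptyᵇ : ∀ {k} → Subset k → Bool
  nonemptyᵇ []ᵛ       = false
  nonemptyᵇ (b ∷ᵛ J) = b ∨ nonemptyᵇ J

  _⊆ᵇ_ : ∀ {k} → Subset k → Subset k → Bool
  []ᵛ         ⊆ᵇ []ᵛ       = true
  (false ∷ᵛ J) ⊆ᵇ (_ ∷ᵛ K) = J ⊆ᵇ K
  (true ∷ᵛ J)  ⊆ᵇ (c ∷ᵛ K) = c ∧ J ⊆ᵇ K

  does-≡ : ∀ {P : Set} (P? : Dec P) {b} → (b ≡ true → P) → (P → b ≡ true) → does P? ≡ b
  does-≡ (yes _) {true}  _ _ = refl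
  does-≡ (yes p) {false} _ P⇒b with () ← P⇒b p
  does-≡ (no ¬p) {true}  b⇒P _ = ⊥-elim (¬p (b⇒P refl))
  does-≡ (no _)  {false} _ _ = refl

  nonemptyᵇ⇒ : ∀ {k} (J : Subset k) → nonemptyᵇ J ≡ true → Nonempty J
  nonemptyᵇ⇒ (true ∷ᵛ J)  _ = fzero , here
  nonemptyᵇ⇒ (false ∷ᵛ J) e = let j , j∈J = nonemptyᵇ⇒ J e in fsuc j , there j∈J

  ⇒nonemptyᵇ : ∀ {k} (J : Subset k) → Nonempty J → nonemptyᵇ J ≡ true
  ⇒nonemptyᵇ (true ∷ᵛ J)  _                  = refl
  ⇒nonemptyᵇ (false ∷ᵛ J) (fsuc j , there j∈J) = ⇒nonemptyᵇ J (j , j∈J)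

  ⊆ᵇ⇒ : ∀ {k} (J K : Subset k) → J ⊆ᵇ K ≡ true → J ⊆ K
  ⊆ᵇ⇒ (true ∷ᵛ J)  (true ∷ᵛ K) _ here        = here
  ⊆ᵇ⇒ (true ∷ᵛ J)  (true ∷ᵛ K) e (there j∈J) = there (⊆ᵇ⇒ J K e j∈J)
  ⊆ᵇ⇒ (false ∷ᵛ J) (_ ∷ᵛ K)    e (there j∈J) = there (⊆ᵇ⇒ J K e j∈J)

  ⇒⊆ᵇ : ∀ {k} (J K : Subset k) → J ⊆ K → J ⊆ᵇ K ≡ true
  ⇒⊆ᵇ []ᵛ          []ᵛ          _   = refl
  ⇒⊆ᵇ (false ∷ᵛ J) (_ ∷ᵛ K)     J⊆K = ⇒⊆ᵇ J K (drop-∷-⊆ J⊆K)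
  ⇒⊆ᵇ (true ∷ᵛ J)  (true ∷ᵛ K)  J⊆K = ⇒⊆ᵇ J K (drop-∷-⊆ J⊆K)
  ⇒⊆ᵇ (true ∷ᵛ J)  (false ∷ᵛ K) J⊆K with J⊆K here
  ... | ()

  does-nonempty? : ∀ {k} (J : Subset k) → does (nonempty? J) ≡ nonemptyᵇ J
  does-nonempty? J = does-≡ (nonempty? J) (nonemptyᵇ⇒ J) (⇒nonemptyᵇ J)

  does-⊆? : ∀ {k} (J K : Subset k) → does (J ⊆? K) ≡ J ⊆ᵇ K
  does-⊆? J K = does-≡ (J ⊆? K) (⊆ᵇ⇒ J K) (⇒⊆ᵇ J K)

  ⊆ᵇ-∩ : ∀ {k} (J I K : Subset k) → J ⊆ᵇ (I ∩ K) ≡ J ⊆ᵇ I ∧ J ⊆ᵇ K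
  ⊆ᵇ-∩ []ᵛ          []ᵛ          []ᵛ          = refl
  ⊆ᵇ-∩ (false ∷ᵛ J) (_ ∷ᵛ I)     (_ ∷ᵛ K)     = ⊆ᵇ-∩ J I K
  ⊆ᵇ-∩ (true ∷ᵛ J)  (false ∷ᵛ I) (_ ∷ᵛ K)     = refl
  ⊆ᵇ-∩ (true ∷ᵛ J)  (true ∷ᵛ I)  (false ∷ᵛ K) = sym (BoolP.∧-zeroʳ (J ⊆ᵇ I))
  ⊆ᵇ-∩ (true ∷ᵛ J)  (true ∷ᵛ I)  (true ∷ᵛ K)  = ⊆ᵇ-∩ J I K

  empty-⊆ᵇ : ∀ {k} (J K : Subset k) → nonemptyᵇ J ≡ false → J ⊆ᵇ K ≡ true
  empty-⊆ᵇ []ᵛ          []ᵛ      _ = refl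
  empty-⊆ᵇ (false ∷ᵛ J) (_ ∷ᵛ K) e = empty-⊆ᵇ J K e

  ∣empty∣ : ∀ {k} (J : Subset k) → nonemptyᵇ J ≡ false → ∣ J ∣ ≡ 0
  ∣empty∣ []ᵛ          _ = refl
  ∣empty∣ (false ∷ᵛ J) e = ∣empty∣ J e

  ∣nonempty∣ : ∀ {k} (J : Subset k) → nonemptyᵇ J ≡ true → ∣ J ∣ ≡ suc (∣ J ∣ ∸ 1)
  ∣nonempty∣ (true ∷ᵛ J)  _ = refl
  ∣nonempty∣ (false ∷ᵛ J) e = ∣nonempty∣ J e

  sumℤ-allSubsets-suc : ∀ {k} (f : Subset (suc k) → ℤ) →
    sumℤ (map f (allSubsets (suc k)))
    ≡ sumℤ (map (f ∘ (outside ∷ᵛ_)) (allSubsets k)) +ℤ sumℤ (map (f ∘ (inside ∷ᵛ_)) (allSubsets k))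
  sumℤ-allSubsets-suc {k} f = trans (sumℤ-map-++ f (map (outside ∷ᵛ_) A) (map (inside ∷ᵛ_) A))
    (cong₂ _+ℤ_ (cong sumℤ (sym (ListP.map-∘ A))) (cong sumℤ (sym (ListP.map-∘ A))))
    where A = allSubsets k

  sumℤ-𝟙-empty : ∀ k → sumℤ (map (λ J → 𝟙 (not (nonemptyᵇ J))) (allSubsets k)) ≡ 1ℤ
  sumℤ-𝟙-empty zero    = refl
  sumℤ-𝟙-empty (suc k) = trans (sumℤ-allSubsets-suc {k} (λ J → 𝟙 (not (nonemptyᵇ J))))
    (cong₂ _+ℤ_ (sumℤ-𝟙-empty k) (sumℤ-zero (allSubsets k)))

  signedIfSubsetOf : ∀ {k} → Subset k → Subset k → ℤ
  signedIfSubsetOf K J = if J ⊆ᵇ K then -1ℤ ^ ∣ J ∣ else 0ℤ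

  -- The subsets of a nonempty K come in pairs J, J ∪ {j} of opposite sign.
  sumℤ-signedIfSubsetOf : ∀ {k} (K : Subset k) →
    sumℤ (map (signedIfSubsetOf K) (allSubsets k)) ≡ 𝟙 (not (nonemptyᵇ K))
  sumℤ-signedIfSubsetOf []ᵛ          = refl
  sumℤ-signedIfSubsetOf {suc k} (false ∷ᵛ K) = trans (sumℤ-allSubsets-suc {k} (signedIfSubsetOf (false ∷ᵛ K)))
    (trans (cong₂ _+ℤ_ (sumℤ-signedIfSubsetOf K) (sumℤ-zero (allSubsets k))) (ℤP.+-identityʳ _))
  sumℤ-signedIfSubsetOf {suc k} (true ∷ᵛ K) = begin
    sumℤ (map (signedIfSubsetOf (true ∷ᵛ K)) (allSubsets (suc k)))
      ≡⟨ sumℤ-allSubsets-suc {k} (signedIfSubsetOf (true ∷ᵛ K)) ⟩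
    e +ℤ sumℤ (map (signedIfSubsetOf (true ∷ᵛ K) ∘ (inside ∷ᵛ_)) (allSubsets k))
      ≡⟨ cong (e +ℤ_) (sumℤ-cong (allSubsets k) negated) ⟩
    e +ℤ sumℤ (map (λ J → -1ℤ *ℤ signedIfSubsetOf K J) (allSubsets k))
      ≡⟨ cong (e +ℤ_) (sym (*-sumℤ -1ℤ (allSubsets k) (signedIfSubsetOf K))) ⟩
    e +ℤ -1ℤ *ℤ e
      ≡⟨ solve 1 (λ x → x :+ con -1ℤ :* x := con 0ℤ) refl e ⟩
    0ℤ ∎
    where
    e = sumℤ (map (signedIfSubsetOf K) (allSubsets k))
    negated : ∀ J → signedIfSubsetOf (true ∷ᵛ K) (inside ∷ᵛ J) ≡ -1ℤ *ℤ signedIfSubsetOf K J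
    negated J with J ⊆ᵇ K
    ... | true  = refl
    ... | false = refl

  inclusion–exclusion-term : ∀ {k} (I K J : Subset k) →
    𝟙 (nonemptyᵇ J ∧ J ⊆ᵇ I) *ℤ (-1ℤ ^ (∣ J ∣ ∸ 1) *ℤ 𝟙 (J ⊆ᵇ K))
    ≡ 𝟙 (not (nonemptyᵇ J)) -ℤ signedIfSubsetOf (I ∩ K) J
  inclusion–exclusion-term I K J with nonemptyᵇ J in nonempty
  ... | false rewrite empty-⊆ᵇ J (I ∩ K) nonempty | ∣empty∣ J nonempty = refl
  ... | true  rewrite ⊆ᵇ-∩ J I K | ∣nonempty∣ J nonempty with J ⊆ᵇ I | J ⊆ᵇ K
  ... | true  | true  =
    solve 1 (λ s → con 1ℤ :* (s :* con 1ℤ) := con 0ℤ :- con -1ℤ :* s) refl (-1ℤ ^ (∣ J ∣ ∸ 1))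
  ... | true  | false =
    solve 1 (λ s → con 1ℤ :* (s :* con 0ℤ) := con 0ℤ :- con 0ℤ) refl (-1ℤ ^ (∣ J ∣ ∸ 1))
  ... | false | _     = refl

inclusion–exclusion : ∀ {k} (I K : Subset k) →
  sumℤ (map (λ J → 𝟙 (does (nonempty? J) ∧ does (J ⊆? I)) *ℤ (-1ℤ ^ (∣ J ∣ ∸ 1) *ℤ 𝟙 (does (J ⊆? K))))
            (allSubsets k))
  ≡ 𝟙 (does (nonempty? (I ∩ K)))
inclusion–exclusion {k} I K = begin
  sumℤ (map (λ J → 𝟙 (does (nonempty? J) ∧ does (J ⊆? I)) *ℤ (-1ℤ ^ (∣ J ∣ ∸ 1) *ℤ 𝟙 (does (J ⊆? K))))
            (allSubsets k))
    ≡⟨ sumℤ-cong (allSubsets k) term ⟩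
  sumℤ (map (λ J → 𝟙 (not (nonemptyᵇ J)) -ℤ signedIfSubsetOf (I ∩ K) J) (allSubsets k))
    ≡⟨ sumℤ-map-- (allSubsets k) _ _ ⟩
  sumℤ (map (λ J → 𝟙 (not (nonemptyᵇ J))) (allSubsets k))
    -ℤ sumℤ (map (signedIfSubsetOf (I ∩ K)) (allSubsets k))
    ≡⟨ cong₂ _-ℤ_ (sumℤ-𝟙-empty k) (sumℤ-signedIfSubsetOf (I ∩ K)) ⟩
  1ℤ -ℤ 𝟙 (not (nonemptyᵇ (I ∩ K)))
    ≡⟨ 1-𝟙-not (nonemptyᵇ (I ∩ K)) ⟩
  𝟙 (nonemptyᵇ (I ∩ K))
    ≡⟨ cong 𝟙 (sym (does-nonempty? (I ∩ K))) ⟩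
  𝟙 (does (nonempty? (I ∩ K))) ∎
  where
  term : ∀ J → 𝟙 (does (nonempty? J) ∧ does (J ⊆? I)) *ℤ (-1ℤ ^ (∣ J ∣ ∸ 1) *ℤ 𝟙 (does (J ⊆? K)))
             ≡ 𝟙 (not (nonemptyᵇ J)) -ℤ signedIfSubsetOf (I ∩ K) J
  term J rewrite does-nonempty? J | does-⊆? J I | does-⊆? J K = inclusion–exclusion-term I K J
  1-𝟙-not : ∀ b → 1ℤ -ℤ 𝟙 (not b) ≡ 𝟙 b
  1-𝟙-not true  = refl
  1-𝟙-not false = refl

count-inclusion–exclusion : ∀ {k} {A : Set} (I : Subset k) (H : A → Subset k) (U : List A) →
  + length (filter (λ x → nonempty? (I ∩ H x)) U)
  ≡ sumℤ (map (λ J → -1ℤ ^ (∣ J ∣ ∸ 1) *ℤ + length (filter (λ x → J ⊆? H x) U))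
              (filter (λ J → nonempty? J ×-dec J ⊆? I) (allSubsets k)))
count-inclusion–exclusion {k} {A} I H U = sym (begin
  sumℤ (map (λ J → -1ℤ ^ (∣ J ∣ ∸ 1) *ℤ + length (filter (λ x → J ⊆? H x) U))
            (filter (λ J → nonempty? J ×-dec J ⊆? I) (allSubsets k)))
    ≡⟨ sumℤ-filter (λ J → nonempty? J ×-dec J ⊆? I) _ (allSubsets k) ⟩
  sumℤ (map (λ J → 𝟙 (admissible J) *ℤ (-1ℤ ^ (∣ J ∣ ∸ 1) *ℤ + length (filter (λ x → J ⊆? H x) U)))
            (allSubsets k))
    ≡⟨ sumℤ-cong (allSubsets k) expand ⟩
  sumℤ (map (λ J → sumℤ (map (term J) U)) (allSubsets k))
    ≡⟨ sumℤ-swap term (allSubsets k) U ⟩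
  sumℤ (map (λ x → sumℤ (map (λ J → term J x) (allSubsets k))) U)
    ≡⟨ sumℤ-cong U (λ x → inclusion–exclusion I (H x)) ⟩
  sumℤ (map (λ x → 𝟙 (does (nonempty? (I ∩ H x)))) U)
    ≡⟨ length-filter (λ x → nonempty? (I ∩ H x)) U ⟨
  + length (filter (λ x → nonempty? (I ∩ H x)) U) ∎)
  where
  admissible : Subset k → Bool
  admissible J = does (nonempty? J) ∧ does (J ⊆? I)
  term : Subset k → A → ℤ
  term J x = 𝟙 (admissible J) *ℤ (-1ℤ ^ (∣ J ∣ ∸ 1) *ℤ 𝟙 (does (J ⊆? H x)))
  expand : ∀ J → 𝟙 (admissible J) *ℤ (-1ℤ ^ (∣ J ∣ ∸ 1) *ℤ + length (filter (λ x → J ⊆? H x) U))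
                 ≡ sumℤ (map (term J) U)
  expand J = begin
    𝟙 (admissible J) *ℤ (s *ℤ + length (filter (λ x → J ⊆? H x) U))
      ≡⟨ cong (λ c → 𝟙 (admissible J) *ℤ (s *ℤ c)) (length-filter (λ x → J ⊆? H x) U) ⟩
    𝟙 (admissible J) *ℤ (s *ℤ sumℤ (map (λ x → 𝟙 (does (J ⊆? H x))) U))
      ≡⟨ cong (𝟙 (admissible J) *ℤ_) (*-sumℤ s U _) ⟩
    𝟙 (admissible J) *ℤ sumℤ (map (λ x → s *ℤ 𝟙 (does (J ⊆? H x))) U)
      ≡⟨ *-sumℤ (𝟙 (admissible J)) U _ ⟩
    sumℤ (map (term J) U) ∎
    where s = -1ℤ ^ (∣ J ∣ ∸ 1)

largestPart : List ℕ → ℕ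
largestPart l = part l 0

consPart : ℕ → List ℕ → List ℕ
consPart zero    l = l
consPart (suc k) l = suc k ∷ l

part-drop : ∀ l i → part (drop 1 l) i ≡ part l (suc i)
part-drop []      _ = refl
part-drop (_ ∷ _) _ = refl

drop-isPartition : ∀ {l} → IsPartition l → IsPartition (drop 1 l)
drop-isPartition {[]}    isPartition                 = isPartition
drop-isPartition {_ ∷ _} (_ ∷ᵃ positive , decreasing) = positive , decreasing ∘ suc

largestPart-drop : ∀ {l} → IsPartition l → largestPart (drop 1 l) ≤ largestPart l
largestPart-drop {[]}    _                = z≤n
largestPart-drop {_ ∷ _} (_ , decreasing) = decreasing 0

size-drop : ∀ l → size (drop 1 l) + largestPart l ≡ size l
size-drop []      = refl
size-drop (x ∷ l) = ℕP.+-comm (size l) x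

⪰-drop : ∀ lam mu → lam ⪰ mu → mu ⪰ drop 1 lam
⪰-drop lam mu lam⪰mu i =
  subst (_≤ part mu i) (sym (part-drop lam i)) (proj₂ (lam⪰mu i)) ,
  subst (part mu (suc i) ≤_) (sym (part-drop lam i)) (proj₁ (lam⪰mu (suc i)))

empty-of-largestPart≤0 : ∀ {l} → IsPartition l → largestPart l ≤ 0 → l ≡ []
empty-of-largestPart≤0 {[]}    _              _   = refl
empty-of-largestPart≤0 {_ ∷ _} (0<x ∷ᵃ _ , _) x≤0 = ⊥-elim (ℕP.<⇒≱ 0<x x≤0)

consPart-isPartition : ∀ {l} m → IsPartition l → largestPart l ≤ m → IsPartition (consPart m l)
consPart-isPartition zero    isPartition               _ = isPartition
consPart-isPartition (suc k) (positive , decreasing) l≤m =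
  s≤s z≤n ∷ᵃ positive , λ { zero → l≤m ; (suc i) → decreasing i }

largestPart-consPart : ∀ {l} m → largestPart l ≤ m → largestPart (consPart m l) ≡ m
largestPart-consPart zero    l≤0 = ℕP.n≤0⇒n≡0 l≤0
largestPart-consPart (suc k) _   = refl

size-consPart : ∀ m l → size (consPart m l) ≡ size l + m
size-consPart zero    l = sym (ℕP.+-identityʳ (size l))
size-consPart (suc k) l = ℕP.+-comm (suc k) (size l)

consPart-drop : ∀ {l} → IsPartition l → consPart (largestPart l) (drop 1 l) ≡ l
consPart-drop {[]}        _ = refl
consPart-drop {suc _ ∷ _} _ = refl
consPart-drop {zero ∷ _}  (() ∷ᵃ _ , _)

drop-consPart : ∀ {l} m → IsPartition l → largestPart l ≤ m → drop 1 (consPart m l) ≡ l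
drop-consPart zero    isPartition l≤0 with refl ← empty-of-largestPart≤0 isPartition l≤0 = refl
drop-consPart (suc k) _           _   = refl

consPart-⪰ : ∀ {mu nu} m → IsPartition mu → largestPart mu ≤ m → mu ⪰ nu → consPart m nu ⪰ mu
consPart-⪰ zero isPartition mu≤0 mu⪰nu with refl ← empty-of-largestPart≤0 isPartition mu≤0 =
  λ i → z≤n , proj₁ (mu⪰nu (suc i))
consPart-⪰ (suc k) _ mu≤m mu⪰nu zero    = mu≤m , proj₁ (mu⪰nu 0)
consPart-⪰ (suc k) _ _    mu⪰nu (suc i) = proj₂ (mu⪰nu i) , proj₁ (mu⪰nu (suc i))

-- Peaks of the profile

-- Heights a rise across every ⊕ step of the profile s and fall across every ⊖ step, so a bound m
-- that a reaches somewhere is also reached at a peak (s j , s (j+1)) = (⊕ , ⊖).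
module PeakOfMaximum {h m : ℕ} (h≥1 : 1 ≤ h) (s : ℕ → Sign) (a : ℕ → ℕ)
  (s-start : s 0 ≡ opposite (s 1)) (s-end : s (suc h) ≡ opposite (s h))
  (a≤m : ∀ j → j ≤ h → a j ≤ m)
  (ascent  : ∀ j → j < h → s (suc j) ≡ ⊕ → a j ≤ a (suc j))
  (descent : ∀ j → j < h → s (suc j) ≡ ⊖ → a (suc j) ≤ a j) where

  IsPeak : ℕ → Set
  IsPeak j = j ≤ h × s j ≡ ⊕ × s (suc j) ≡ ⊖ × a j ≡ m

  private
    reaches : ∀ {j k} → a j ≡ m → a j ≤ a k → k ≤ h → a k ≡ m
    reaches {k = k} aj≡m aj≤ak k≤h = ℕP.≤-antisym (a≤m k k≤h) (subst (_≤ a k) aj≡m aj≤ak)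

    walkRight : ∀ d j → d + j ≡ h → s j ≡ ⊕ → a j ≡ m → ∃ IsPeak
    walkRight d j d+j≡h sj aj with s (suc j) in sj′
    ... | ⊖ = j , subst (j ≤_) d+j≡h (ℕP.m≤n+m j d) , sj , sj′ , aj
    walkRight zero    j refl sj _ | ⊕ with () ← trans (sym sj′) (trans s-end (cong opposite sj))
    walkRight (suc d) j d+j≡h sj aj | ⊕ =
      walkRight d (suc j) (trans (ℕP.+-suc d j) d+j≡h) sj′ (reaches aj (ascent j j<h sj′) j<h)
      where
      j<h : j < h
      j<h = subst (j <_) d+j≡h (s≤s (ℕP.m≤n+m j d))

    walkLeft : ∀ j → j ≤ h → s (suc j) ≡ ⊖ → a j ≡ m → ∃ IsPeak
    walkLeft j j≤h sj′ aj with s j in sj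
    ... | ⊕ = j , j≤h , sj , sj′ , aj
    walkLeft zero    _   sj′ _  | ⊖ with () ← trans (sym sj) (trans s-start (cong opposite sj′))
    walkLeft (suc j) j<h sj′ aj | ⊖ =
      walkLeft j (ℕP.<⇒≤ j<h) sj (reaches aj (descent j j<h sj) (ℕP.<⇒≤ j<h))

  peak-of-maximum : ∀ j → j ≤ h → a j ≡ m → ∃ IsPeak
  peak-of-maximum j j≤h aj with s j in sj
  ... | ⊕ = walkRight (h ∸ j) j (ℕP.m∸n+n≡m j≤h) sj aj
  peak-of-maximum zero _ a0 | ⊖ = walkRight (h ∸ 1) 1 (ℕP.m∸n+n≡m h≥1) s1 (reaches a0 (ascent 0 h≥1 s1) h≥1)
    where
    s1 : s 1 ≡ ⊕
    s1 = trans (sym (SignP.opposite-selfInverse (sym s-start))) (cong opposite sj)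
  peak-of-maximum (suc j) j<h aj | ⊖ = walkLeft j (ℕP.<⇒≤ j<h) sj (reaches aj (descent j j<h sj) (ℕP.<⇒≤ j<h))

lookup≡vget : ∀ {A : Set} {k} (v : Vec A k) (d : A) (j : Fin k) → lookup v j ≡ vget v d (toℕ j)
lookup≡vget (x ∷ᵛ v) d fzero    = refl
lookup≡vget (x ∷ᵛ v) d (fsuc j) = lookup≡vget v d j

vget≡lookup : ∀ {A : Set} {k} (v : Vec A k) (d : A) {j} (j<k : j < k) → vget v d j ≡ lookup v (fromℕ< j<k)
vget≡lookup v d j<k = trans (cong (vget v d) (sym (FinP.toℕ-fromℕ< j<k))) (sym (lookup≡vget v d (fromℕ< j<k)))

δ̂-suc : ∀ {h} (δ : Vec Sign h) {j} → j < h → δ̂ δ (suc j) ≡ vget δ ⊕ j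
δ̂-suc {h} δ {j} j<h with j <ᵇ h | ℕP.<⇒<ᵇ j<h
... | true | _ = refl

lookup≡δ̂ : ∀ {h} (δ : Vec Sign h) (k : Fin h) → lookup δ k ≡ δ̂ δ (suc (toℕ k))
lookup≡δ̂ δ k = trans (lookup≡vget δ ⊕ k) (sym (δ̂-suc δ (FinP.toℕ<n k)))

δ̂-end : ∀ {ℓ} (δ : Vec Sign (suc ℓ)) → δ̂ δ (suc (suc ℓ)) ≡ opposite (δ̂ δ (suc ℓ))
δ̂-end {ℓ} δ with ℓ <ᵇ ℓ in ℓ<ᵇℓ
... | false = cong opposite (sym (δ̂-suc δ (ℕP.n<1+n ℓ)))
... | true  = ⊥-elim (ℕP.<-irrefl refl (ℕP.<ᵇ⇒< ℓ ℓ (subst T (sym ℓ<ᵇℓ) _)))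

row : ∀ {k} → Vec (List ℕ) k → ℕ → List ℕ
row x j = vget x [] j

row-step : ∀ {h} {δ : Vec Sign h} {x} → IsDSPP δ x → ∀ {j} → j < h →
           Step (δ̂ δ (suc j)) (row x j) (row x (suc j))
row-step {δ = δ} {x} (_ , steps) {j} j<h =
  subst (λ i → Step (δ̂ δ (suc i)) (row x i) (row x (suc i))) (FinP.toℕ-fromℕ< j<h)
    (subst₂ (Step (δ̂ δ (suc (toℕ k))))
      (trans (lookup≡vget x [] (inject₁ k)) (cong (row x) (FinP.toℕ-inject₁ k)))
      (lookup≡vget x [] (fsuc k))
      (subst (λ s → Step s (lookup x (inject₁ k)) (lookup x (fsuc k))) (lookup≡δ̂ δ k) (steps k)))
  where k = fromℕ< j<h

largestPart-⪰ : ∀ lam mu → lam ⪰ mu → largestPart mu ≤ largestPart lam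
largestPart-⪰ _ _ lam⪰mu = proj₁ (lam⪰mu 0)

largestPart≤maxPart : ∀ {k} (x : Vec (List ℕ) k) j → largestPart (lookup x j) ≤ maxPart x
largestPart≤maxPart (l ∷ᵛ x) fzero    = ℕP.m≤m⊔n (largestPart l) (maxPart x)
largestPart≤maxPart (l ∷ᵛ x) (fsuc j) =
  ℕP.≤-trans (largestPart≤maxPart x j) (ℕP.m≤n⊔m (largestPart l) (maxPart x))

maxPart≤ : ∀ {k m} (x : Vec (List ℕ) k) → (∀ j → largestPart (lookup x j) ≤ m) → maxPart x ≤ m
maxPart≤ []ᵛ      _       = z≤n
maxPart≤ (l ∷ᵛ x) bounded = ℕP.⊔-lub (bounded fzero) (maxPart≤ x (bounded ∘ fsuc))

maxPart-attained : ∀ {k} (x : Vec (List ℕ) (suc k)) → ∃ λ j → largestPart (lookup x j) ≡ maxPart x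
maxPart-attained (l ∷ᵛ []ᵛ) = fzero , sym (ℕP.⊔-identityʳ (largestPart l))
maxPart-attained (l ∷ᵛ x@(_ ∷ᵛ _)) with maxPart-attained x | ℕP.≤-total (largestPart l) (maxPart x)
... | j , attained | inj₁ l≤x = fsuc j , trans attained (sym (ℕP.m≤n⇒m⊔n≡n l≤x))
... | _            | inj₂ x≤l = fzero , sym (ℕP.m≥n⇒m⊔n≡m x≤l)

rowsReaching : ∀ {k} → ℕ → Vec (List ℕ) k → Subset k
rowsReaching m x = Vec.map (λ l → largestPart l ≡ᵇ m) x

∈-rowsReaching : ∀ {k m} {x : Vec (List ℕ) k} {j} → j ∈ₛ rowsReaching m x ⇔ largestPart (lookup x j) ≡ m
∈-rowsReaching {m = m} {x} {j} = mk⇔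
  (λ j∈ → ℕP.≡ᵇ⇒≡ _ m (from BoolP.T-≡ (trans (sym (VecP.lookup-map j _ x)) (VecP.[]=⇒lookup j∈))))
  (λ reaches → VecP.lookup⇒[]= j _ (trans (VecP.lookup-map j _ x) (to BoolP.T-≡ (ℕP.≡⇒≡ᵇ _ m reaches))))

∈-Îδ : ∀ {h} {δ : Vec Sign h} {j} → j ∈ₛ Îδ δ ⇔ (δ̂ δ (toℕ j) ≡ ⊕ × δ̂ δ (suc (toℕ j)) ≡ ⊖)
∈-Îδ {δ = δ} {j} = mk⇔
  (λ j∈ → isPlusMinus⇒ (trans (sym (VecP.lookup∘tabulate peak j)) (VecP.[]=⇒lookup j∈)))
  (λ (s≡⊕ , t≡⊖) → VecP.lookup⇒[]= j _ (trans (VecP.lookup∘tabulate peak j) (⇒isPlusMinus s≡⊕ t≡⊖)))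
  where
  peak : Fin _ → Bool
  peak i = isPlusMinus (δ̂ δ (toℕ i)) (δ̂ δ (suc (toℕ i)))
  isPlusMinus⇒ : ∀ {s t} → isPlusMinus s t ≡ true → s ≡ ⊕ × t ≡ ⊖
  isPlusMinus⇒ {⊕} {⊖} _ = refl , refl
  ⇒isPlusMinus : ∀ {s t} → s ≡ ⊕ → t ≡ ⊖ → isPlusMinus s t ≡ true
  ⇒isPlusMinus refl refl = refl

maxPart≡⇔peakReaches : ∀ {ℓ m} (δ : Vec Sign (suc ℓ)) {x : Vec (List ℕ) (suc (suc ℓ))} →
  IsDSPP δ x → maxPart x ≤ m → maxPart x ≡ m ⇔ Nonempty (Îδ δ ∩ rowsReaching m x)
maxPart≡⇔peakReaches {ℓ} {m} δ {x} dspp max≤m = mk⇔ peak-of-max max-of-peak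
  where
  a : ℕ → ℕ
  a j = largestPart (row x j)

  a≤m : ∀ j → j ≤ suc ℓ → a j ≤ m
  a≤m j j≤h = subst (λ l → largestPart l ≤ m) (sym (vget≡lookup x [] (s≤s j≤h)))
                    (ℕP.≤-trans (largestPart≤maxPart x _) max≤m)

  step : ∀ {s} j → j < suc ℓ → δ̂ δ (suc j) ≡ s → Step s (row x j) (row x (suc j))
  step j j<h refl = row-step {δ = δ} {x} dspp j<h

  open PeakOfMaximum (s≤s z≤n) (δ̂ δ) a refl (δ̂-end δ) a≤m
         (λ j j<h s≡⊕ → largestPart-⪰ (row x (suc j)) (row x j) (step j j<h s≡⊕))
         (λ j j<h s≡⊖ → largestPart-⪰ (row x j) (row x (suc j)) (step j j<h s≡⊖))

  peakRow : ∀ {j} → IsPeak j → Nonempty (Îδ δ ∩ rowsReaching m x)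
  peakRow {j} (j≤h , s≡⊕ , t≡⊖ , aj) = f , x∈p∩q⁺
    ( from ∈-Îδ (subst (λ i → δ̂ δ i ≡ ⊕ × δ̂ δ (suc i) ≡ ⊖) (sym toℕf≡j) (s≡⊕ , t≡⊖))
    , from ∈-rowsReaching (trans (cong largestPart (sym (vget≡lookup x [] (s≤s j≤h)))) aj) )
    where
    f = fromℕ< (s≤s j≤h)
    toℕf≡j : toℕ f ≡ j
    toℕf≡j = FinP.toℕ-fromℕ< (s≤s j≤h)

  peak-of-max : maxPart x ≡ m → Nonempty (Îδ δ ∩ rowsReaching m x)
  peak-of-max max≡m with j , attained ← maxPart-attained x =
    peakRow (proj₂ (peak-of-maximum (toℕ j) (FinP.toℕ≤pred[n] j)
      (trans (cong largestPart (sym (lookup≡vget x [] j))) (trans attained max≡m))))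

  max-of-peak : Nonempty (Îδ δ ∩ rowsReaching m x) → maxPart x ≡ m
  max-of-peak (j , j∈) = ℕP.≤-antisym max≤m
    (subst (_≤ maxPart x) (to ∈-rowsReaching (proj₂ (x∈p∩q⁻ (Îδ δ) _ j∈))) (largestPart≤maxPart x j))

-- Stripping the largest parts of the rows in J ⊆ Î_δ

onSubset : {A : Set} {k : ℕ} → (A → A) → Subset k → Vec A k → Vec A k
onSubset f = Vec.zipWith (λ b a → if b then f a else a)

lookup-onSubset : {A : Set} {k : ℕ} (f : A → A) (J : Subset k) (x : Vec A k) (j : Fin k) →
  lookup (onSubset f J x) j ≡ (if lookup J j then f (lookup x j) else lookup x j)
lookup-onSubset f J x j = VecP.lookup-zipWith (λ b a → if b then f a else a) j J x

onSubset-elim : {A : Set} {k : ℕ} (P : A → Set) (f : A → A) (J : Subset k) (x : Vec A k) (j : Fin k) →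
  (lookup J j ≡ true → P (f (lookup x j))) → (lookup J j ≡ false → P (lookup x j)) →
  P (lookup (onSubset f J x) j)
onSubset-elim P f J x j inJ outJ rewrite lookup-onSubset f J x j with lookup J j
... | true  = inJ refl
... | false = outJ refl

onSubset-inverse : {A : Set} {k : ℕ} (f g : A → A) (J : Subset k) (x : Vec A k) →
  (∀ j → lookup J j ≡ true → g (f (lookup x j)) ≡ lookup x j) → onSubset g J (onSubset f J x) ≡ x
onSubset-inverse f g []ᵛ          []ᵛ      _       = refl
onSubset-inverse f g (false ∷ᵛ J) (a ∷ᵛ x) inverse = cong (a ∷ᵛ_) (onSubset-inverse f g J x (inverse ∘ fsuc))
onSubset-inverse f g (true ∷ᵛ J)  (a ∷ᵛ x) inverse =
  cong₂ _∷ᵛ_ (inverse fzero refl) (onSubset-inverse f g J x (inverse ∘ fsuc))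

-- Removing the largest part of the row at a peak (⊕ , ⊖) reverses both interlacings around it:
-- the peak becomes a valley (⊖ , ⊕).
step-drop : ∀ {s₀ s₁ s₂ : Sign} b₀ b₁ {l₀ l₁} →
  (b₀ ≡ true → s₀ ≡ ⊕ × s₁ ≡ ⊖) → (b₁ ≡ true → s₁ ≡ ⊕ × s₂ ≡ ⊖) → Step s₁ l₀ l₁ →
  Step (if b₁ then s₂ else if b₀ then s₀ else s₁)
       (if b₀ then drop 1 l₀ else l₀) (if b₁ then drop 1 l₁ else l₁)
step-drop true  true              peak₀ peak₁ _
  with () ← trans (sym (proj₂ (peak₀ refl))) (proj₁ (peak₁ refl))
step-drop false true  {l₀} {l₁} _     peak₁ l₁⪰l₀ with refl , refl ← peak₁ refl = ⪰-drop l₁ l₀ l₁⪰l₀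
step-drop true  false {l₀} {l₁} peak₀ _     l₀⪰l₁ with refl , refl ← peak₀ refl = ⪰-drop l₀ l₁ l₀⪰l₁
step-drop false false           _     _     step  = step

step-consPart : ∀ {s₀ s₁ s₂ : Sign} m b₀ b₁ {l₀ l₁} →
  (b₀ ≡ true → s₀ ≡ ⊕ × s₁ ≡ ⊖) → (b₁ ≡ true → s₁ ≡ ⊕ × s₂ ≡ ⊖) →
  IsPartition l₀ → largestPart l₀ ≤ m → IsPartition l₁ → largestPart l₁ ≤ m →
  Step (if b₁ then s₂ else if b₀ then s₀ else s₁) l₀ l₁ →
  Step s₁ (if b₀ then consPart m l₀ else l₀) (if b₁ then consPart m l₁ else l₁)
step-consPart m true  true  peak₀ peak₁ _ _ _ _ _
  with () ← trans (sym (proj₂ (peak₀ refl))) (proj₁ (peak₁ refl))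
step-consPart m false true  {l₀} {l₁} _ peak₁ p₀ l₀≤m _ _ l₀⪰l₁
  with refl , refl ← peak₁ refl = consPart-⪰ {l₀} {l₁} m p₀ l₀≤m l₀⪰l₁
step-consPart m true  false {l₀} {l₁} peak₀ _ _ _ p₁ l₁≤m l₁⪰l₀
  with refl , refl ← peak₀ refl = consPart-⪰ {l₁} {l₀} m p₁ l₁≤m l₁⪰l₀
step-consPart m false false _ _ _ _ _ _ step = step

bit≡lookup : ∀ {k} (J : Subset k) (j : Fin k) → bit J (toℕ j) ≡ lookup J j
bit≡lookup (b ∷ᵛ J) fzero    = refl
bit≡lookup (b ∷ᵛ J) (fsuc j) = bit≡lookup J j

lookup-σ̂ : ∀ {h} (J : Subset (suc h)) (δ : Vec Sign h) (k : Fin h) →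
  lookup (σ̂ J δ) k ≡ (if lookup J (fsuc k) then δ̂ δ (suc (suc (toℕ k)))
                      else if lookup J (inject₁ k) then δ̂ δ (toℕ k) else δ̂ δ (suc (toℕ k)))
lookup-σ̂ J δ k = trans (VecP.lookup∘tabulate swapped k)
  (cong₂ (λ b₀ b₁ → if b₁ then δ̂ δ (suc (suc (toℕ k))) else if b₀ then δ̂ δ (toℕ k) else δ̂ δ (suc (toℕ k)))
         (trans (cong (bit J) (sym (FinP.toℕ-inject₁ k))) (bit≡lookup J (inject₁ k)))
         (bit≡lookup J (fsuc k)))
  where
  swapped : Fin _ → Sign
  swapped k = if bit J (suc (toℕ k)) then δ̂ δ (suc (suc (toℕ k)))
              else if bit J (toℕ k) then δ̂ δ (toℕ k) else δ̂ δ (suc (toℕ k))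

module HeadStripping {h} (δ : Vec Sign h) (m : ℕ) (n : Vec ℕ (suc h))
                     {J : Subset (suc h)} (J⊆Î : J ⊆ Îδ δ) where

  Covered : Vec (List ℕ) (suc h) → Set
  Covered x = BoundedDSPP δ m n x × J ⊆ rowsReaching m x

  strip restore : Vec (List ℕ) (suc h) → Vec (List ℕ) (suc h)
  strip   = onSubset (drop 1) J
  restore = onSubset (consPart m) J

  private
    peak : ∀ j → lookup J j ≡ true → δ̂ δ (toℕ j) ≡ ⊕ × δ̂ δ (suc (toℕ j)) ≡ ⊖
    peak j j∈J = to ∈-Îδ (J⊆Î (VecP.lookup⇒[]= j J j∈J))

    peak-inject₁ : ∀ k → lookup J (inject₁ k) ≡ true → δ̂ δ (toℕ k) ≡ ⊕ × δ̂ δ (suc (toℕ k)) ≡ ⊖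
    peak-inject₁ k k∈J =
      subst (λ i → δ̂ δ i ≡ ⊕ × δ̂ δ (suc i) ≡ ⊖) (FinP.toℕ-inject₁ k) (peak (inject₁ k) k∈J)

    largestPart≤m : ∀ (x : Vec (List ℕ) (suc h)) → maxPart x ≤ m → ∀ j → largestPart (lookup x j) ≤ m
    largestPart≤m x max≤m j = ℕP.≤-trans (largestPart≤maxPart x j) max≤m

    reaches : ∀ {x} → J ⊆ rowsReaching m x → ∀ j → lookup J j ≡ true → largestPart (lookup x j) ≡ m
    reaches J⊆R j j∈J = to ∈-rowsReaching (J⊆R (VecP.lookup⇒[]= j J j∈J))

  strip-maps : ∀ x → Covered x → RHSSet δ J m n (strip x)
  strip-maps x (((isPartition , steps) , max≤m , sizes) , J⊆R) =
    (isPartition′ , steps′) , maxPart≤ (strip x) largest≤m , sizes′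
    where
    isPartition′ : ∀ j → IsPartition (lookup (strip x) j)
    isPartition′ j = onSubset-elim IsPartition (drop 1) J x j
      (λ _ → drop-isPartition (isPartition j)) (λ _ → isPartition j)
    largest≤m : ∀ j → largestPart (lookup (strip x) j) ≤ m
    largest≤m j = onSubset-elim (λ l → largestPart l ≤ m) (drop 1) J x j
      (λ _ → ℕP.≤-trans (largestPart-drop (isPartition j)) (largestPart≤m x max≤m j))
      (λ _ → largestPart≤m x max≤m j)
    sizes′ : ∀ j → size (lookup (strip x) j) + (if lookup J j then m else 0) ≡ lookup n j
    sizes′ j rewrite lookup-onSubset (drop 1) J x j with lookup J j in j∈J
    ... | true  = trans (cong (λ t → size (drop 1 (lookup x j)) + t) (sym (reaches J⊆R j j∈J)))
                        (trans (size-drop (lookup x j)) (sizes j))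
    ... | false = trans (ℕP.+-identityʳ _) (sizes j)
    steps′ : ∀ k → Step (lookup (σ̂ J δ) k) (lookup (strip x) (inject₁ k)) (lookup (strip x) (fsuc k))
    steps′ k rewrite lookup-σ̂ J δ k | lookup-onSubset (drop 1) J x (inject₁ k)
                   | lookup-onSubset (drop 1) J x (fsuc k) =
      step-drop (lookup J (inject₁ k)) (lookup J (fsuc k)) (peak-inject₁ k) (peak (fsuc k))
        (subst (λ s → Step s (lookup x (inject₁ k)) (lookup x (fsuc k))) (lookup≡δ̂ δ k) (steps k))

  restore-maps : ∀ μ → RHSSet δ J m n μ → Covered (restore μ)
  restore-maps μ ((isPartition , steps) , max≤m , sizes) =
    ((isPartition′ , steps′) , maxPart≤ (restore μ) largest≤m , sizes′) , J⊆R
    where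
    isPartition′ : ∀ j → IsPartition (lookup (restore μ) j)
    isPartition′ j = onSubset-elim IsPartition (consPart m) J μ j
      (λ _ → consPart-isPartition m (isPartition j) (largestPart≤m μ max≤m j)) (λ _ → isPartition j)
    largest≤m : ∀ j → largestPart (lookup (restore μ) j) ≤ m
    largest≤m j = onSubset-elim (λ l → largestPart l ≤ m) (consPart m) J μ j
      (λ _ → ℕP.≤-reflexive (largestPart-consPart m (largestPart≤m μ max≤m j)))
      (λ _ → largestPart≤m μ max≤m j)
    sizes′ : ∀ j → size (lookup (restore μ) j) ≡ lookup n j
    sizes′ j = onSubset-elim (λ l → size l ≡ lookup n j) (consPart m) J μ j
      (λ j∈J → trans (size-consPart m (lookup μ j))
                     (subst (λ b → size (lookup μ j) + (if b then m else 0) ≡ lookup n j) j∈J (sizes j)))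
      (λ j∉J → trans (sym (ℕP.+-identityʳ _))
                     (subst (λ b → size (lookup μ j) + (if b then m else 0) ≡ lookup n j) j∉J (sizes j)))
    J⊆R : J ⊆ rowsReaching m (restore μ)
    J⊆R {j} j∈J = from ∈-rowsReaching (onSubset-elim (λ l → largestPart l ≡ m) (consPart m) J μ j
      (λ _ → largestPart-consPart m (largestPart≤m μ max≤m j))
      (λ j∉J → case trans (sym j∉J) (VecP.[]=⇒lookup j∈J) of λ ()))
    steps′ : ∀ k → Step (lookup δ k) (lookup (restore μ) (inject₁ k)) (lookup (restore μ) (fsuc k))
    steps′ k rewrite lookup≡δ̂ δ k | lookup-onSubset (consPart m) J μ (inject₁ k)
                   | lookup-onSubset (consPart m) J μ (fsuc k) =
      step-consPart m (lookup J (inject₁ k)) (lookup J (fsuc k)) (peak-inject₁ k) (peak (fsuc k))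
        (isPartition (inject₁ k)) (largestPart≤m μ max≤m (inject₁ k))
        (isPartition (fsuc k)) (largestPart≤m μ max≤m (fsuc k))
        (subst (λ s → Step s (lookup μ (inject₁ k)) (lookup μ (fsuc k))) (lookup-σ̂ J δ k) (steps k))

  restore∘strip : ∀ x → Covered x → restore (strip x) ≡ x
  restore∘strip x (((isPartition , _) , _) , J⊆R) = onSubset-inverse (drop 1) (consPart m) J x λ j j∈J →
    trans (cong (λ t → consPart t (drop 1 (lookup x j))) (sym (reaches J⊆R j j∈J)))
          (consPart-drop (isPartition j))

  strip∘restore : ∀ μ → RHSSet δ J m n μ → strip (restore μ) ≡ μ
  strip∘restore μ ((isPartition , _) , max≤m , _) = onSubset-inverse (consPart m) (drop 1) J μ λ j _ →
    drop-consPart m (isPartition j) (largestPart≤m μ max≤m j)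

module _ {h} (δ : Vec Sign h) (m : ℕ) (n : Vec ℕ (suc h)) where

  boundedDSPPs : List (Vec (List ℕ) (suc h))
  boundedDSPPs = proj₁ (boundedDSPP-enumeration δ m n)

  peakReachingDSPPs : List (Vec (List ℕ) (suc h))
  peakReachingDSPPs = filter (λ x → nonempty? (Îδ δ ∩ rowsReaching m x)) boundedDSPPs

  coveringDSPPs : Subset (suc h) → List (Vec (List ℕ) (suc h))
  coveringDSPPs J = filter (λ x → J ⊆? rowsReaching m x) boundedDSPPs

  -- A J ⊈ Î_δ does not occur in the signed sum, so its set is just enumerated directly.
  rhsCount : Subset (suc h) → ℕ
  rhsCount J with J ⊆? Îδ δ
  ... | yes _ = length (coveringDSPPs J)
  ... | no  _ = length (proj₁ (RHSSet-enumeration δ J m n))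

  rhsCount-hasCount : ∀ J → HasCount (RHSSet δ J m n) (rhsCount J)
  rhsCount-hasCount J with J ⊆? Îδ δ
  ... | no  _   = enumerates⇒hasCount (proj₂ (RHSSet-enumeration δ J m n)) refl
  ... | yes J⊆Î = enumerates⇒hasCount
    (map-enumerates strip restore strip-maps restore-maps restore∘strip strip∘restore
       (filter-enumerates (λ x → J ⊆? rowsReaching m x) (proj₂ (boundedDSPP-enumeration δ m n))))
    (ListP.length-map strip (coveringDSPPs J))
    where open HeadStripping δ m n J⊆Î

  rhsCount-⊆Îδ : ∀ {J} → J ⊆ Îδ δ → rhsCount J ≡ length (coveringDSPPs J)
  rhsCount-⊆Îδ {J} J⊆Î with J ⊆? Îδ δ
  ... | yes _   = refl
  ... | no J⊈Î = ⊥-elim (J⊈Î J⊆Î)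

peakReachingDSPPs-enumerates : ∀ {ℓ} (δ : Vec Sign (suc ℓ)) m n →
  Enumerates (LHSSet δ m n) (peakReachingDSPPs δ m n)
peakReachingDSPPs-enumerates δ m n =
  enumerates-⇔ (λ x → mk⇔
      (λ ((dspp , max≤m , sizes) , peak) → dspp , from (maxPart≡⇔peakReaches δ dspp max≤m) peak , sizes)
      (λ (dspp , max≡m , sizes) → (dspp , ℕP.≤-reflexive max≡m , sizes) ,
                                  to (maxPart≡⇔peakReaches δ dspp (ℕP.≤-reflexive max≡m)) max≡m))
    (filter-enumerates (λ x → nonempty? (Îδ δ ∩ rowsReaching m x)) (proj₂ (boundedDSPP-enumeration δ m n)))

proposition3p3 : (h : ℕ) → 1 ≤ h → (δ : Vec Sign h) → (m : ℕ) → (n : Vec ℕ (suc h)) →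
    Σ ℕ λ c → Σ (Subset (suc h) → ℕ) λ cJ →
      HasCount (LHSSet δ m n) c ×
      (∀ J → HasCount (RHSSet δ J m n) (cJ J)) ×
      + c ≡ signedSum δ cJ
proposition3p3 (suc ℓ) _ δ m n =
  length (peakReachingDSPPs δ m n) , rhsCount δ m n ,
  enumerates⇒hasCount (peakReachingDSPPs-enumerates δ m n) refl , rhsCount-hasCount δ m n ,
  (begin
    + length (peakReachingDSPPs δ m n)
      ≡⟨ count-inclusion–exclusion (Îδ δ) (rowsReaching m) (boundedDSPPs δ m n) ⟩
    sumℤ (map (λ J → -1ℤ ^ (∣ J ∣ ∸ 1) *ℤ + length (coveringDSPPs δ m n J)) (admissibleJ δ))
      ≡⟨ sumℤ-cong-∈ (admissibleJ δ) (λ J J∈ →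
           cong (λ c → -1ℤ ^ (∣ J ∣ ∸ 1) *ℤ + c)
                (sym (rhsCount-⊆Îδ δ m n (proj₂ (proj₂ (∈-filter⁻ _ {xs = allSubsets (suc (suc ℓ))} J∈)))))) ⟩
    signedSum δ (rhsCount δ m n) ∎)
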